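{- Let $p$ be a prime and let $(x[n])_{n\ge 1}$ be a sequence over $\mathrm{GF}(p)$ whose sequence of partial sums $S[n]=\sum_{k=1}^n x[k]\in\mathrm{GF}(p)$ is periodic with period $P\ge 1$ (i.e. $S[n+P]=S[n]$ for all $n\ge1$), where $P\not\equiv 0\pmod p$. Then the series $\sum_{n\ge1}x[n]$ is Cesàro convergent over $\mathrm{GF}(p)$ in the sense defined in the context.
   Context: Identify each $S[k]\in\mathrm{GF}(p)$ with its representative integer in $\{0,1,\dots,p-1\}$ and set $\sigma_n := \frac{1}{n}\sum_{k=1}^n S[k]\in\mathbb{Q}$. The series $\sum_{n\ge 1} x[n]$ over $\mathrm{GF}(p)$ is called Cesàro convergent (to $\sigma$) if the limit $\lim_{n\to\infty}\sigma_n$ exists in $\mathbb{Q}$ and its reduction modulo $p$, $\sigma := (\lim_{n\to\infty}\sigma_n) \bmod p$, is a well-defined element of $\mathrm{GF}(p)$ (i.e. the limit, in lowest terms, has denominator not divisible by $p$). -}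

module Defs where

open import Data.Nat using (ℕ; zero; suc; _+_; _≤_; NonZero)
open import Data.Nat.DivMod using (_%_)
open import Data.Fin using (Fin; toℕ)
open import Data.Integer using (+_)
open import Data.Rational using (ℚ; _-_; ∣_∣; _<_; 0ℚ)
import Data.Rational as ℚ
open import Data.Product using (Σ; ∃; _×_)

sum1 : (ℕ → ℕ) → ℕ → ℕ
sum1 f zero    = 0
sum1 f (suc n) = sum1 f n + f (suc n)

-- Elements of GF(p) are represented by Fin p;
-- the value x 0 is never used (sequences are indexed from 1).
S : (p : ℕ) .{{_ : NonZero p}} → (ℕ → Fin p) → ℕ → ℕ
S p x n = sum1 (λ k → toℕ (x k)) n % p

-- Cesàro means σ_n = (1/n) Σ_{k=1}^n S[k] ∈ ℚ  (for n ≥ 1; σ_0 := 0 is a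
-- dummy value that does not affect limits).
σ : (p : ℕ) .{{_ : NonZero p}} → (ℕ → Fin p) → ℕ → ℚ
σ p x zero    = 0ℚ
σ p x (suc m) = (+ sum1 (S p x) (suc m)) ℚ./ suc m

ConvergesTo : (ℕ → ℚ) → ℚ → Set
ConvergesTo f L = (ε : ℚ) → 0ℚ < ε → ∃ λ N → (n : ℕ) → N ≤ n → ∣ f n - L ∣ < ε

-- Cesàro convergence over GF(p): lim σ_n exists in ℚ and, in lowest terms,
-- its denominator is not divisible by p (so σ = lim mod p is well defined).
CesaroConvergent : (p : ℕ) .{{_ : NonZero p}} → (ℕ → Fin p) → Set
CesaroConvergent p x =
  Σ ℚ λ L → ConvergesTo (σ p x) L × (¬ (p ∣ ℚ.denominatorℕ L))
  where
  open import Relation.Nullary using (¬_)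
  open import Data.Nat.Divisibility using (_∣_)

module Submission where

-- Write T n = Σ_{k=1}^n S[k] ∈ ℕ for the running sums of the
-- partial sums and A = T P.  Periodicity of S gives T (n + P) = T n + A, so the
-- "discrepancy" D n = P·T n − A·n is P-periodic; it is therefore determined by
-- its values on 0 ≤ n < P, where S[k] ≤ p bounds it by P·p·P.  Consequently
--   | σ_n − A/P | = | D n | / (n·P) ≤ P·p·P / (n·P) → 0,
-- so σ_n converges to A/P in ℚ.  The reduced denominator of A/P divides P, and
-- p ∤ P, so p does not divide it.

open import Defs
open import Data.Nat using (ℕ; zero; suc; _+_; _*_; _≤_; _<_; NonZero; z≤n; s≤s)
open import Data.Nat.Properties
open import Data.Nat.DivMod using (_%_; _/_; m%n<n; m≡m%n+[m/n]*n)
open import Data.Nat.Divisibility using (_∣_; divides; ∣-trans)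
open import Data.Nat.Primality using (Prime)
open import Data.Nat.Coprimality using (Coprime)
open import Data.Fin using (Fin)
open import Data.Integer using (ℤ; +_; -[1+_]; _⊖_; ∣_∣)
import Data.Integer as ℤ
import Data.Integer.Properties as ℤP
open import Data.Integer.GCD using (gcd)
open import Data.Rational using (ℚ; mkℚ; toℚᵘ)
import Data.Rational as ℚ
import Data.Rational.Properties as ℚP
open import Data.Rational.Unnormalised using (mkℚᵘ; *<*)
import Data.Rational.Unnormalised as ℚᵘ
import Data.Rational.Unnormalised.Properties as ℚᵘP
open import Data.Product using (_,_)
open import Relation.Nullary using (¬_)
open import Relation.Binary.PropositionalEquality
  using (_≡_; refl; sym; trans; cong; cong₂; subst; module ≡-Reasoning)

sum1-≤ : (f : ℕ → ℕ) (c : ℕ) → (∀ k → f k ≤ c) → ∀ n → sum1 f n ≤ n * c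
sum1-≤ f c f≤c zero    = z≤n
sum1-≤ f c f≤c (suc n) =
  ≤-trans (+-mono-≤ (sum1-≤ f c f≤c n) (f≤c (suc n))) (≤-reflexive (+-comm (n * c) c))

sum1-periodic : (f : ℕ → ℕ) (P : ℕ) → (∀ n → 1 ≤ n → f (n + P) ≡ f n) →
                ∀ n → sum1 f (n + P) ≡ sum1 f n + sum1 f P
sum1-periodic f P per zero    = refl
sum1-periodic f P per (suc n) = begin
    sum1 f (n + P) + f (suc n + P)       ≡⟨ cong₂ _+_ (sum1-periodic f P per n) (per (suc n) (s≤s z≤n)) ⟩
    sum1 f n + sum1 f P + f (suc n)      ≡⟨ +-assoc (sum1 f n) (sum1 f P) _ ⟩
    sum1 f n + (sum1 f P + f (suc n))    ≡⟨ cong (λ z → sum1 f n + z) (+-comm (sum1 f P) _) ⟩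
    sum1 f n + (f (suc n) + sum1 f P)    ≡⟨ +-assoc (sum1 f n) _ (sum1 f P) ⟨
    sum1 f (suc n) + sum1 f P            ∎
  where open ≡-Reasoning

periodic-% : {A : Set} (g : ℕ → A) (P : ℕ) .{{_ : NonZero P}} →
             (∀ n → g (n + P) ≡ g n) → ∀ n → g n ≡ g (n % P)
periodic-% g P per n =
  trans (cong g (m≡m%n+[m/n]*n n P)) (shift (n % P) (n / P))
  where
  shift : ∀ r q → g (r + q * P) ≡ g r
  shift r zero    = cong g (+-identityʳ r)
  shift r (suc q) = begin
      g (r + (P + q * P))   ≡⟨ cong g (trans (+-assoc r (q * P) P) (cong (λ z → r + z) (+-comm (q * P) P))) ⟨
      g (r + q * P + P)     ≡⟨ per (r + q * P) ⟩
      g (r + q * P)         ≡⟨ shift r q ⟩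
      g r                   ∎
    where open ≡-Reasoning

discrepancy : (ℕ → ℕ) → ℕ → ℕ → ℤ
discrepancy T P n = (T n * P) ⊖ (T P * n)

discrepancy-periodic : (T : ℕ → ℕ) (P : ℕ) → (∀ n → T (n + P) ≡ T n + T P) →
                       ∀ n → discrepancy T P (n + P) ≡ discrepancy T P n
discrepancy-periodic T P step n = begin
    (T (n + P) * P) ⊖ (A * (n + P))       ≡⟨ cong₂ _⊖_ lhs (trans (*-distribˡ-+ A n P) (+-comm (A * n) (A * P))) ⟩
    (A * P + T n * P) ⊖ (A * P + A * n)   ≡⟨ ℤP.+-cancelˡ-⊖ (A * P) _ _ ⟩
    (T n * P) ⊖ (A * n)                   ∎
  where
  open ≡-Reasoning
  A = T P
  lhs : T (n + P) * P ≡ A * P + T n * P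
  lhs = trans (cong (_* P) (step n)) (trans (*-distribʳ-+ P (T n) A) (+-comm (T n * P) (A * P)))

-- Under the same hypothesis, if T n ≤ n·c then the discrepancy is bounded by
-- P·c·P: by periodicity it suffices to look at n < P.
discrepancy-bounded : (T : ℕ → ℕ) (P c : ℕ) .{{_ : NonZero P}} →
                      (∀ n → T (n + P) ≡ T n + T P) → (∀ n → T n ≤ n * c) →
                      ∀ n → ∣ discrepancy T P n ∣ ≤ P * c * P
discrepancy-bounded T P c step T≤ n =
  subst (λ d → ∣ d ∣ ≤ P * c * P)
        (sym (periodic-% (discrepancy T P) P (discrepancy-periodic T P step) n))
        (small (n % P) (m%n<n n P))
  where
  small : ∀ r → r < P → ∣ discrepancy T P r ∣ ≤ P * c * P
  small r r<P = ≤-trans (ℤP.∣m⊝n∣≤m⊔n (T r * P) (T P * r))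
    (⊔-lub (*-monoˡ-≤ P (≤-trans (T≤ r) (*-monoˡ-≤ c (<⇒≤ r<P))))
           (*-mono-≤ (T≤ P) (<⇒≤ r<P)))

denominator-/-∣ : (i : ℤ) (n : ℕ) .{{_ : NonZero n}} → ℚ.denominatorℕ (i ℚ./ n) ∣ n
denominator-/-∣ i n = divides ∣ g ∣ (begin
    n                                   ≡⟨ cong ∣_∣ (ℚP.↧-/ i n) ⟨
    ∣ ℚ.denominator (i ℚ./ n) ℤ.* g ∣   ≡⟨ ℤP.abs-* (ℚ.denominator (i ℚ./ n)) g ⟩
    ℚ.denominatorℕ (i ℚ./ n) * ∣ g ∣    ≡⟨ *-comm (ℚ.denominatorℕ (i ℚ./ n)) ∣ g ∣ ⟩
    ∣ g ∣ * ℚ.denominatorℕ (i ℚ./ n)    ∎)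
  where
  open ≡-Reasoning
  g = gcd i (+ n)

cross-numerator : (t a m q : ℕ) →
                  + t ℤ.* + suc q ℤ.+ ℤ.- (+ a) ℤ.* + suc m ≡ (t * suc q) ⊖ (a * suc m)
cross-numerator t a m q = begin
    + t ℤ.* + suc q ℤ.+ ℤ.- (+ a) ℤ.* + suc m     ≡⟨ cong₂ (λ u v → u ℤ.+ v) (sym (ℤP.pos-* t (suc q)))
                                                       (trans (sym (ℤP.neg-distribˡ-* (+ a) (+ suc m))) (cong ℤ.-_ (sym (ℤP.pos-* a (suc m))))) ⟩
    + (t * suc q) ℤ.+ ℤ.- + (a * suc m)           ≡⟨ ℤP.m-n≡m⊖n (t * suc q) (a * suc m) ⟩
    (t * suc q) ⊖ (a * suc m)                     ∎
  where open ≡-Reasoning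

fraction-distance-< : (t a m q k d : ℕ) .(c : Coprime (suc k) (suc d)) →
  ∣ (t * suc q) ⊖ (a * suc m) ∣ * suc d < suc k * (suc m * suc q) →
  ℚ.∣ (+ t) ℚ./ suc m ℚ.- (+ a) ℚ./ suc q ∣ ℚ.< mkℚ (+ suc k) d c
fraction-distance-< t a m q k d c bound =
  ℚP.toℚᵘ-cancel-< (ℚᵘP.<-respˡ-≃ (ℚᵘP.≃-sym toℚᵘ-distance) (*<* integer-bound))
  where
  u = mkℚᵘ (+ t) m
  v = mkℚᵘ (+ a) q
  x = (+ t) ℚ./ suc m
  y = (+ a) ℚ./ suc q
  toℚᵘ-distance : toℚᵘ ℚ.∣ x ℚ.- y ∣ ℚᵘ.≃ ℚᵘ.∣ u ℚᵘ.- v ∣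
  toℚᵘ-distance = ℚᵘP.≃-trans (ℚP.toℚᵘ-homo-∣-∣ (x ℚ.- y)) (ℚᵘP.∣-∣-cong
    (ℚᵘP.≃-trans (ℚP.toℚᵘ-homo-+ x (ℚ.- y))
      (ℚᵘP.+-cong (ℚP.toℚᵘ-fromℚᵘ u) (ℚᵘP.≃-trans (ℚP.toℚᵘ-homo‿- y) (ℚᵘP.-‿cong (ℚP.toℚᵘ-fromℚᵘ v))))))
  integer-bound : + ∣ + t ℤ.* + suc q ℤ.+ ℤ.- (+ a) ℤ.* + suc m ∣ ℤ.* + suc d
                  ℤ.< + suc k ℤ.* + (suc m * suc q)
  integer-bound
    rewrite cross-numerator t a m q
          | sym (ℤP.pos-* ∣ (t * suc q) ⊖ (a * suc m) ∣ (suc d))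
          | sym (ℤP.pos-* (suc k) (suc m * suc q))
    = ℤ.+<+ bound

bounded-discrepancy-converges : (f : ℕ → ℚ) (T : ℕ → ℕ) (a q B : ℕ) →
  (∀ m → f (suc m) ≡ (+ T (suc m)) ℚ./ suc m) →
  (∀ n → ∣ (T n * suc q) ⊖ (a * n) ∣ ≤ B) →
  ConvergesTo f ((+ a) ℚ./ suc q)
bounded-discrepancy-converges f T a q B f≡ bounded (mkℚ (+ zero) d c) (ℚ.*<* (ℤ.+<+ ()))
bounded-discrepancy-converges f T a q B f≡ bounded (mkℚ -[1+ k ] d c) (ℚ.*<* ())
bounded-discrepancy-converges f T a q B f≡ bounded (mkℚ (+ suc k) d c) _ = suc (B * suc d) , close
  where
  close : ∀ n → suc (B * suc d) ≤ n → ℚ.∣ f n ℚ.- (+ a) ℚ./ suc q ∣ ℚ.< mkℚ (+ suc k) d c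
  close (suc m) N≤n rewrite f≡ m = fraction-distance-< (T (suc m)) a m q k d c
    (≤-trans (s≤s (*-monoˡ-≤ (suc d) (bounded (suc m))))
      (≤-trans N≤n (≤-trans (m≤m*n (suc m) (suc q)) (m≤n*m _ (suc k)))))

mainTheorem10 : (p : ℕ) .{{_ : NonZero p}} → Prime p →
    (x : ℕ → Fin p) → (P : ℕ) → 1 ≤ P → ¬ (p ∣ P) →
    ((n : ℕ) → 1 ≤ n → S p x (n + P) ≡ S p x n) →
    CesaroConvergent p x
mainTheorem10 p _ x (suc q) _ p∤P per =
  (+ T P) ℚ./ P , converges , λ p∣den → p∤P (∣-trans p∣den (denominator-/-∣ (+ T P) P))
  where
  P = suc q
  T : ℕ → ℕ
  T = sum1 (S p x)
  T≤ : ∀ n → T n ≤ n * p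
  T≤ = sum1-≤ (S p x) p (λ k → <⇒≤ (m%n<n _ p))
  step : ∀ n → T (n + P) ≡ T n + T P
  step = sum1-periodic (S p x) P per
  converges : ConvergesTo (σ p x) ((+ T P) ℚ./ P)
  converges = bounded-discrepancy-converges (σ p x) T (T P) q (P * p * P) (λ m → refl)
    (discrepancy-bounded T P p step T≤)
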